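{- Let $I$ be a finite index set and let $\{S_i\}_{i\in I}$ be communicating systems, $S_i=(M_{x})_{x\in\mathbf{P}_i}$ over $\mathbf{P}_i$ and $\mathbb{A}_i$, with the sets $\mathbf{P}_i$ pairwise disjoint. Let $H=\{h_i\}_{i\in I}$ be a set of interfaces ($h_i\in\mathbf{P}_i$ for each $i$) such that each CFSM $M_{h_i}$ has no mixed states. Let $\mathbb{K}=(M_{k_i})_{i\in I}$ be a connection policy for $H$ complying with a connection model $\mathrm{CM}$ for $H$, and let $S=\mathcal{MC}(\{S_i\}_{i\in I},\mathbb{K})$ be the multicomposition. Let $\mathcal{P}$ be one of the properties deadlock-freeness, reception-error-freeness, or progress. If $\mathcal{P}$ holds for every $S_i$ ($i\in I$) and for $\mathbb{K}$, then $\mathcal{P}$ holds for $S$. Moreover, the same conclusion holds when $\mathcal{P}$ is orphan-message-freeness, even without the assumption that the interfaces $M_{h_i}$ have no mixed states.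
   Context: Participant names and messages are drawn from countably infinite sets. For a finite set $\mathbf{P}$ of participants and finite set $\mathbb{A}$ of messages, the channels are $C_{\mathbf{P}}=\{pq\mid p,q\in\mathbf{P},p\neq q\}$ and the actions are $pq!a$ (output, sending $a$ on channel $pq$; subject $p$) and $pq?a$ (input, consuming $a$ from channel $pq$; subject $q$), for $pq\in C_{\mathbf{P}}$, $a\in\mathbb{A}$. A CFSM over $\mathbf{P},\mathbb{A}$ is $M=(Q,q_0,\mathbb{A},\delta)$ with $Q$ finite, $q_0\in Q$, $\delta\subseteq Q\times \mathit{Act}\times Q$, all actions having the same subject, called the name of $M$. A state is final if it has no outgoing transition; sending (resp. receiving) if it is not final and all outgoing transitions are outputs (resp. inputs); mixed if it has an outgoing output and an outgoing input transition. $\mathrm{in}(M)$ (resp. $\mathrm{out}(M)$) is the set of messages occurring in input (resp. output) actions of $\delta$; write $\mathrm{in}(h)$, $\mathrm{out}(h)$ for the machine named $h$. A communicating system over $\mathbf{P},\mathbb{A}$ is $S=(M_p)_{p\in\mathbf{P}}$, $M_p=(Q_p,q_{0p},\mathbb{A},\delta_p)$ a CFSM named $p$. A configuration is $s=(\vec q,\vec w)$ with $\vec q=(q_p)_{p\in\mathbf P}$, $q_p\in Q_p$, and $\vec w=(w_{pq})_{pq\in C_{\mathbf P}}$, $w_{pq}\in\mathbb{A}^*$; the initial one is $((q_{0p})_p,\vec\varepsilon)$. $s\xrightarrow{l}s'$ if either $l=sr!a$, $(q_s,l,q'_s)\in\delta_s$, all other local states unchanged, $w'_{sr}=w_{sr}\cdot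 a$ and other channels unchanged; or $l=sr?a$, $(q_r,l,q'_r)\in\delta_r$, other local states unchanged, $w_{sr}=a\cdot w'_{sr}$ and other channels unchanged. $\mathsf{RC}(S)$ is the set of configurations reachable from the initial one. Properties of $S$: a configuration $s$ is a deadlock if $\vec w=\vec\varepsilon$ and every $q_p$ is a receiving state; $S$ is deadlock-free if no reachable configuration is a deadlock. $s$ is an orphan-message configuration if every $q_p$ is final and $\vec w\neq\vec\varepsilon$; $S$ is orphan-message free if none is reachable. $s$ is an unspecified reception configuration if there is $r$ with $q_r$ receiving and for all $s'$, $a$: $(q_r,s'r?a,q'_r)\in\delta_r$ implies $|w_{s'r}|>0$ and $w_{s'r}\notin a\cdot\mathbb{A}^*$; $S$ is reception-error free if none is reachable. $S$ has progress if every reachable $s$ either has some $s\to s'$ or all its local states are final. Multicomposition setting: interfaces $H=\{h_i\}_{i\in I}$ with $h_i\in\mathbf P_i$. A connection model for $H$ is $\mathrm{CM}\subseteq H\times\text{Messages}\times H$ such that for each $h\in H$ and message $a$: if $a\in\mathrm{in}(h)$ there is $h'\in H$, $h'\neq h$, with $a\in\mathrm{out}(h')$ and $(h,a,h')\in\mathrm{CM}$; if $a\in\mathrm{out}(h)$ there is $h'\neq h$ with $a\in\mathrm{in}(h')$ and $(h',a,h)\in\mathrm{CM}$; every message occurring in $\mathrm{CM}$ occurs as input or output of some interface. For each $i$ let $k_i$ be a fresh name (the "dotted" copy of $h_i$). For $M_{h_i}=(Q,q_0,\mathbb A,\delta)$, its local connection policy set w.r.t. $\mathrm{CM}$ is the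 set of CFSMs named $k_i$ of the form $(\dot Q,\dot q_0,\mathbb A,\dot\delta)$, where $\dot Q=\{\dot q\mid q\in Q\}$ is a copy of $Q$ and $\dot\delta$ is a minimal relation such that: (*) for every $(q,rh_i?a,q')\in\delta$ there is $j\neq i$ with $(\dot q,k_ik_j!a,\dot q')\in\dot\delta$ and $(h_i,a,h_j)\in\mathrm{CM}$; (**) for every $(q,h_ir!a,q')\in\delta$ there is $j\neq i$ with $(\dot q,k_jk_i?a,\dot q')\in\dot\delta$ and $(h_j,a,h_i)\in\mathrm{CM}$. A connection policy for $H$ complying with $\mathrm{CM}$ is a communicating system $\mathbb K=(M_{k_i})_{i\in I}$ with each $M_{k_i}$ in the local connection policy set of $M_{h_i}$. Gateway: for $M_{h_i}=(Q,q_0,\mathbb A,\delta)$ and $M_{k_i}=(\dot Q,\dot q_0,\mathbb A,\dot\delta)$, the gateway $M_{h_i}\looparrowleft M_{k_i}=(Q\cup\widehat Q,q_0,\mathbb A,\widehat\delta)$, where $\widehat Q=\{q^{(q,l,q')}\mid(q,l,q')\in\delta\}$ are fresh states and $\widehat\delta$ consists of: for each $(q,h_is!a,q')\in\delta$ and each $(\dot q,k_jk_i?a,\dot q')\in\dot\delta$, the transitions $(q,h_jh_i?a,\hat q)$ and $(\hat q,h_is!a,q')$ with $\hat q=q^{(q,h_is!a,q')}$; and for each $(q,sh_i?a,q')\in\delta$ and each $(\dot q,k_ik_j!a,\dot q')\in\dot\delta$, the transitions $(q,sh_i?a,\hat q)$ and $(\hat q,h_ih_j!a,q')$ with $\hat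 q=q^{(q,sh_i?a,q')}$. The multicomposition $\mathcal{MC}(\{S_i\}_{i\in I},\mathbb K)$ is the communicating system over $\mathbf P=\bigcup_i\mathbf P_i$ and $\mathbb A=\bigcup_i\mathbb A_i$ consisting of $M_p$ for every $p\notin H$ and of $M_{h_i}\looparrowleft M_{k_i}$ in place of $M_{h_i}$ for each $i\in I$. -}

module Defs where

open import Data.Nat using (ℕ)
open import Data.Unit using (⊤)
open import Data.Empty using (⊥)
open import Data.List using (List; []; _∷_; _++_; [_])
open import Data.List.Membership.Propositional using (_∈_)
open import Data.Product using (Σ; ∃; ∃₂; _×_; _,_)
open import Data.Sum using (_⊎_; inj₁; inj₂)
open import Relation.Nullary using (¬_; yes; no)
open import Relation.Binary.PropositionalEquality using (_≡_; _≢_)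
open import Relation.Binary.Definitions using (DecidableEquality)
open import Relation.Binary.Construct.Closure.ReflexiveTransitive using (Star)

Msg : Set
Msg = ℕ

-- Actions over a participant type X.
--   send p q a  represents  pq!a   (subject p)
--   recv p q a  represents  pq?a   (subject q)
data Act (X : Set) : Set where
  send : X → X → Msg → Act X
  recv : X → X → Msg → Act X

module _ {X : Set} where

  subject : Act X → X
  subject (send p q a) = p
  subject (recv p q a) = q

  msg : Act X → Msg
  msg (send p q a) = a
  msg (recv p q a) = a

  ValidChannel : Act X → Set
  ValidChannel (send p q a) = p ≢ q
  ValidChannel (recv p q a) = p ≢ q

  IsOutput : Act X → Set
  IsOutput (send _ _ _) = ⊤
  IsOutput (recv _ _ _) = ⊥

  IsInput : Act X → Set
  IsInput (send _ _ _) = ⊥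
  IsInput (recv _ _ _) = ⊤

mapAct : {X Y : Set} → (X → Y) → Act X → Act Y
mapAct f (send p q a) = send (f p) (f q) a
mapAct f (recv p q a) = recv (f p) (f q) a

Finite : Set → Set
Finite X = Σ (List X) (λ l → ∀ x → x ∈ l)

record CFSM (X : Set) : Set₁ where
  field
    Q       : Set
    Qfinite : Finite Q
    q0      : Q
    δ       : List (Q × Act X × Q)

IsCFSMNamed : {X : Set} → X → CFSM X → Set
IsCFSMNamed p M = ∀ {q l q'} → (q , l , q') ∈ CFSM.δ M → subject l ≡ p × ValidChannel l

record Machine (X : Set) : Set₁ where
  field
    Q  : Set
    q0 : Q
    Δ  : Q → Act X → Q → Set

⟦_⟧ : {X : Set} → CFSM X → Machine X
⟦ M ⟧ = record { Q = CFSM.Q M ; q0 = CFSM.q0 M ; Δ = λ q l q' → (q , l , q') ∈ CFSM.δ M }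

module _ {X : Set} (M : Machine X) where
  open Machine M

  Final : Q → Set
  Final q = ∀ l q' → ¬ Δ q l q'

  Receiving : Q → Set
  Receiving q = ¬ Final q × (∀ l q' → Δ q l q' → IsInput l)

  Sending : Q → Set
  Sending q = ¬ Final q × (∀ l q' → Δ q l q' → IsOutput l)

  Mixed : Q → Set
  Mixed q = (∃₂ λ l q' → Δ q l q' × IsOutput l) × (∃₂ λ l q' → Δ q l q' × IsInput l)

System : Set → Set₁
System X = X → Machine X

record Config {X : Set} (S : System X) : Set where
  field
    st  : (p : X) → Machine.Q (S p)
    buf : X → X → List Msg
open Config public

module _ {X : Set} (S : System X) where

  initial : Config S
  initial = record { st = λ p → Machine.q0 (S p) ; buf = λ _ _ → [] }

  StepL : Config S → Act X → Config S → Set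
  StepL c (send s r a) c' =
    Machine.Δ (S s) (st c s) (send s r a) (st c' s)
    × (∀ p → p ≢ s → st c' p ≡ st c p)
    × buf c' s r ≡ buf c s r ++ [ a ]
    × (∀ p q → ¬ (p ≡ s × q ≡ r) → buf c' p q ≡ buf c p q)
  StepL c (recv s r a) c' =
    Machine.Δ (S r) (st c r) (recv s r a) (st c' r)
    × (∀ p → p ≢ r → st c' p ≡ st c p)
    × buf c s r ≡ a ∷ buf c' s r
    × (∀ p q → ¬ (p ≡ s × q ≡ r) → buf c' p q ≡ buf c p q)

  _⟶_ : Config S → Config S → Set
  c ⟶ c' = ∃ λ l → StepL c l c'

  Reachable : Config S → Set
  Reachable c = Star _⟶_ initial c

  AllEmpty : Config S → Set
  AllEmpty c = ∀ p q → p ≢ q → buf c p q ≡ []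

  AllFinal : Config S → Set
  AllFinal c = ∀ p → Final (S p) (st c p)

  Deadlock : Config S → Set
  Deadlock c = AllEmpty c × (∀ p → Receiving (S p) (st c p))

  OrphanMessage : Config S → Set
  OrphanMessage c = AllFinal c × (∃₂ λ p q → p ≢ q × buf c p q ≢ [])

  UnspecifiedReception : Config S → Set
  UnspecifiedReception c =
    ∃ λ r → Receiving (S r) (st c r)
      × (∀ s a q' → Machine.Δ (S r) (st c r) (recv s r a) q'
           → buf c s r ≢ [] × ¬ (∃ λ w → buf c s r ≡ a ∷ w))

  DeadlockFree : Set
  DeadlockFree = ∀ c → Reachable c → ¬ Deadlock c

  OrphanMessageFree : Set
  OrphanMessageFree = ∀ c → Reachable c → ¬ OrphanMessage c

  ReceptionErrorFree : Set
  ReceptionErrorFree = ∀ c → Reachable c → ¬ UnspecifiedReception c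

  HasProgress : Set
  HasProgress = ∀ c → Reachable c → (∃ λ c' → c ⟶ c') ⊎ AllFinal c

data Property : Set where
  deadlockFreedom receptionErrorFreedom progress orphanMessageFreedom : Property

Holds : Property → {X : Set} → System X → Set
Holds deadlockFreedom       S = DeadlockFree S
Holds receptionErrorFreedom S = ReceptionErrorFree S
Holds progress              S = HasProgress S
Holds orphanMessageFreedom  S = OrphanMessageFree S

systemOf : {X : Set} → (X → CFSM X) → System X
systemOf M p = ⟦ M p ⟧

IsCommSystem : {X : Set} → (X → CFSM X) → Set
IsCommSystem {X} M = Finite X × (∀ p → IsCFSMNamed p (M p))

-- Index set I; participants of S_i form the type P i;
-- the (disjoint) union of the P_i is Σ I P; the interface of S_i is h i.
-- The dotted name k_i is represented by i itself (participants of the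
-- connection policy have type I).

module _ {I : Set} {P : I → Set} (M : (i : I) → P i → CFSM (P i)) (h : (i : I) → P i) where

  Mh : (i : I) → CFSM (P i)
  Mh i = M i (h i)

  InMsg : (i : I) → Msg → Set
  InMsg i a = ∃ λ q → ∃ λ l → ∃ λ q' → (q , l , q') ∈ CFSM.δ (Mh i) × IsInput l × msg l ≡ a

  OutMsg : (i : I) → Msg → Set
  OutMsg i a = ∃ λ q → ∃ λ l → ∃ λ q' → (q , l , q') ∈ CFSM.δ (Mh i) × IsOutput l × msg l ≡ a

  -- CM ⊆ H × Msg × H is represented by the relation CM i a j ⇔ (h_i,a,h_j) ∈ CM
  IsConnectionModel : (I → Msg → I → Set) → Set
  IsConnectionModel CM =
      (∀ i a → InMsg i a → ∃ λ j → j ≢ i × OutMsg j a × CM i a j)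
    × (∀ i a → OutMsg i a → ∃ λ j → j ≢ i × InMsg j a × CM j a i)
    × (∀ i a j → CM i a j → ∃ λ k → InMsg k a ⊎ OutMsg k a)

  -- transitions of the dotted machine M_{k_i}: states are a copy of Q_{h_i}
  DTrans : I → Set
  DTrans i = CFSM.Q (Mh i) × Act I × CFSM.Q (Mh i)

  module _ (CM : I → Msg → I → Set) (i : I) where
    CondStar : (DTrans i → Set) → Set
    CondStar R = ∀ {q r a q'} → (q , recv r (h i) a , q') ∈ CFSM.δ (Mh i)
                 → ∃ λ j → j ≢ i × R (q , send i j a , q') × CM i a j
    CondStarStar : (DTrans i → Set) → Set
    CondStarStar R = ∀ {q r a q'} → (q , send (h i) r a , q') ∈ CFSM.δ (Mh i)
                 → ∃ λ j → j ≢ i × R (q , recv j i a , q') × CM j a i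

    -- δ̇ is a minimal relation satisfying (*) and (**): it satisfies them,
    -- and every sub-relation satisfying them contains all of δ̇.
    InLocalPolicySet : List (DTrans i) → Set₁
    InLocalPolicySet δ̇ =
        CondStar (_∈ δ̇) × CondStarStar (_∈ δ̇)
      × (∀ (R : DTrans i → Set) → (∀ {t} → R t → t ∈ δ̇)
           → CondStar R → CondStarStar R → ∀ {t} → t ∈ δ̇ → R t)

  IsConnectionPolicy : (CM : I → Msg → I → Set) → ((i : I) → List (DTrans i)) → Set₁
  IsConnectionPolicy CM δ̇ = ∀ i → InLocalPolicySet CM i (δ̇ i)

  policySystem : ((i : I) → List (DTrans i)) → System I
  policySystem δ̇ i = record
    { Q = CFSM.Q (Mh i) ; q0 = CFSM.q0 (Mh i) ; Δ = λ q l q' → (q , l , q') ∈ δ̇ i }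

  -- Gateway M_{h_i} ↫ M_{k_i}.  The fresh state q^(q,l,q') is inj₂ (q,l,q');
  -- only those with (q,l,q') ∈ δ are ever connected.
  module _ (δ̇ : (i : I) → List (DTrans i)) (i : I) where
    private
      Qh = CFSM.Q (Mh i)
      δh = CFSM.δ (Mh i)

    GState : Set
    GState = Qh ⊎ (Qh × Act (P i) × Qh)

    data GΔ : GState → Act (Σ I P) → GState → Set where
      out₁ : ∀ {q s a q' j} → (q , send (h i) s a , q') ∈ δh → (q , recv j i a , q') ∈ δ̇ i
           → GΔ (inj₁ q) (recv (j , h j) (i , h i) a) (inj₂ (q , send (h i) s a , q'))
      out₂ : ∀ {q s a q' j} → (q , send (h i) s a , q') ∈ δh → (q , recv j i a , q') ∈ δ̇ i
           → GΔ (inj₂ (q , send (h i) s a , q')) (send (i , h i) (i , s) a) (inj₁ q')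
      in₁  : ∀ {q s a q' j} → (q , recv s (h i) a , q') ∈ δh → (q , send i j a , q') ∈ δ̇ i
           → GΔ (inj₁ q) (recv (i , s) (i , h i) a) (inj₂ (q , recv s (h i) a , q'))
      in₂  : ∀ {q s a q' j} → (q , recv s (h i) a , q') ∈ δh → (q , send i j a , q') ∈ δ̇ i
           → GΔ (inj₂ (q , recv s (h i) a , q')) (send (i , h i) (j , h j) a) (inj₁ q')

    gateway : Machine (Σ I P)
    gateway = record { Q = GState ; q0 = inj₁ (CFSM.q0 (Mh i)) ; Δ = GΔ }

  liftMachine : (i : I) → Machine (P i) → Machine (Σ I P)
  liftMachine i N = record
    { Q = Machine.Q N ; q0 = Machine.q0 N
    ; Δ = λ q l q' → ∃ λ l₀ → Machine.Δ N q l₀ q' × l ≡ mapAct (i ,_) l₀ }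

  multicomposition : (∀ i → DecidableEquality (P i)) → ((i : I) → List (DTrans i)) → System (Σ I P)
  multicomposition dec δ̇ (i , x) with dec i x (h i)
  ... | yes _ = gateway δ̇ i
  ... | no  _ = liftMachine i ⟦ M i x ⟧

-- Every reachable configuration of the multicomposition projects, up to pointwise equality, onto a reachable
-- configuration of each Sᵢ and of 𝕂: a gateway relaying a message is a step of its interface on one side and a
-- step of the connection policy on the other, and messages between different systems only ever travel between
-- interfaces. Moreover, a gateway is never stuck halfway through a relay. A bad configuration of the
-- multicomposition (deadlock, orphan messages, unspecified reception, no progress) therefore shows up as a bad
-- configuration of some Sᵢ or of 𝕂. Where a waiting gateway is involved, the absence of mixed states decides
-- which: an interface state offering inputs blocks Sᵢ, one offering outputs blocks 𝕂.
module Submission where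

open import Defs
open import Axiom.UniquenessOfIdentityProofs.WithK using (uip)
open import Data.Empty using (⊥; ⊥-elim)
import Data.Fin.Properties as Fin
open import Data.List using (List; []; _∷_; _++_; [_]; lookup)
open import Data.List.Membership.Propositional using (_∈_)
open import Data.List.Relation.Unary.Any using (here; there; index)
open import Data.List.Relation.Unary.Any.Properties using (lookup-index)
open import Data.Product using (Σ; ∃; _×_; _,_; proj₁; proj₂)
open import Data.Product.Properties using (≡-dec; ,-injectiveˡ)
open import Data.Sum using (_⊎_; inj₁; inj₂; map₂; [_,_]′)
open import Data.Unit using (⊤; tt)
open import Relation.Binary.Construct.Closure.ReflexiveTransitive using (Star; ε; _◅_; _◅◅_)
open import Relation.Binary.Definitions using (DecidableEquality)
open import Relation.Binary.PropositionalEquality using (_≡_; _≢_; refl; sym; trans; cong; subst; subst₂)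
open import Relation.Binary.PropositionalEquality.Properties using (subst-sym-subst)
open import Relation.Nullary using (¬_; Dec; yes; no)

Finite⇒≟ : {A : Set} → Finite A → DecidableEquality A
Finite⇒≟ (xs , complete) x y with index (complete x) Fin.≟ index (complete y)
... | yes same = yes (trans (lookup-index (complete x))
                       (trans (cong (lookup xs) same) (sym (lookup-index (complete y)))))
... | no differ = no λ { refl → differ refl }

finite-⊎-∀ : {I A : Set} {B : I → Set} → Finite I → (∀ i → A ⊎ B i) → A ⊎ (∀ i → B i)
finite-⊎-∀ {I} {A} {B} (is , complete) f = map₂ (λ all i → all i (complete i)) (go is)
  where
    go : (l : List I) → A ⊎ (∀ i → i ∈ l → B i)
    go [] = inj₂ λ _ ()
    go (j ∷ l) with f j | go l
    ... | inj₁ a | _       = inj₁ a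
    ... | inj₂ _ | inj₁ a  = inj₁ a
    ... | inj₂ b | inj₂ bs = inj₂ λ { i (here refl) → b ; i (there m) → bs i m }

Unreceivable : List Msg → Msg → Set
Unreceivable w a = w ≢ [] × ¬ (∃ λ v → w ≡ a ∷ v)

record _≈_ {X : Set} {S : System X} (c d : Config S) : Set where
  field
    st≈  : ∀ p → st c p ≡ st d p
    buf≈ : ∀ p q → buf c p q ≡ buf d p q
open _≈_ public

module _ {X : Set} {S : System X} where

  ≈-refl : {c : Config S} → c ≈ c
  ≈-refl = record { st≈ = λ _ → refl ; buf≈ = λ _ _ → refl }

  ≈-sym : {c d : Config S} → c ≈ d → d ≈ c
  ≈-sym E = record { st≈ = λ p → sym (st≈ E p) ; buf≈ = λ p q → sym (buf≈ E p q) }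

  ≈-trans : {c d e : Config S} → c ≈ d → d ≈ e → c ≈ e
  ≈-trans E E' = record
    { st≈ = λ p → trans (st≈ E p) (st≈ E' p) ; buf≈ = λ p q → trans (buf≈ E p q) (buf≈ E' p q) }

  StepL-respˡ : {c d e : Config S} {l : Act X} → c ≈ d → StepL S d l e → StepL S c l e
  StepL-respˡ {e = e} {send s r a} E (t , st-frame , buf-sr , buf-frame) =
    subst (λ z → Machine.Δ (S s) z (send s r a) (st e s)) (sym (st≈ E s)) t
    , (λ p p≢s → trans (st-frame p p≢s) (sym (st≈ E p)))
    , trans buf-sr (cong (_++ [ a ]) (sym (buf≈ E s r)))
    , (λ p q ne → trans (buf-frame p q ne) (sym (buf≈ E p q)))
  StepL-respˡ {e = e} {recv s r a} E (t , st-frame , buf-sr , buf-frame) =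
    subst (λ z → Machine.Δ (S r) z (recv s r a) (st e r)) (sym (st≈ E r)) t
    , (λ p p≢r → trans (st-frame p p≢r) (sym (st≈ E p)))
    , trans (buf≈ E s r) buf-sr
    , (λ p q ne → trans (buf-frame p q ne) (sym (buf≈ E p q)))

  -- Without function extensionality, projections of a reachable configuration are only pointwise equal
  -- to reachable ones.
  Reachable≈ : Config S → Set
  Reachable≈ c = ∃ λ d → Reachable S d × d ≈ c

  Reachable≈-unchanged : {c c' : Config S} → (∀ p → st c' p ≡ st c p) → (∀ p q → buf c' p q ≡ buf c p q)
    → Reachable≈ c → Reachable≈ c'
  Reachable≈-unchanged same-st same-buf (d , r , E) =
    d , r , ≈-trans E (record { st≈ = λ p → sym (same-st p) ; buf≈ = λ p q → sym (same-buf p q) })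

  Reachable≈-step : {c c' : Config S} → _⟶_ S c c' → Reachable≈ c → Reachable≈ c'
  Reachable≈-step {c' = c'} (l , t) (d , r , E) = c' , r ◅◅ ((l , StepL-respˡ E t) ◅ ε) , ≈-refl

  HasStep : Config S → Set
  HasStep c = ∃ λ c' → _⟶_ S c c'

  AllFinal-resp : {c d : Config S} → c ≈ d → AllFinal S d → AllFinal S c
  AllFinal-resp E final p = subst (Final (S p)) (sym (st≈ E p)) (final p)

  Deadlock-resp : {c d : Config S} → c ≈ d → Deadlock S d → Deadlock S c
  Deadlock-resp E (empty , receiving) =
    (λ p q p≢q → trans (buf≈ E p q) (empty p q p≢q))
    , λ p → subst (Receiving (S p)) (sym (st≈ E p)) (receiving p)

  OrphanMessage-resp : {c d : Config S} → c ≈ d → OrphanMessage S d → OrphanMessage S c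
  OrphanMessage-resp E (final , p , q , p≢q , pending) =
    AllFinal-resp E final , p , q , p≢q , λ empty → pending (trans (sym (buf≈ E p q)) empty)

  InputsBlocked : Config S → X → Set
  InputsBlocked c r = ∀ s a q' → Machine.Δ (S r) (st c r) (recv s r a) q' → Unreceivable (buf c s r) a

  UnspecifiedReception-resp : {c d : Config S} → c ≈ d → UnspecifiedReception S d → UnspecifiedReception S c
  UnspecifiedReception-resp E (r , receiving , stuck) =
    r , subst (Receiving (S r)) (sym (st≈ E r)) receiving
    , λ s a q' t → subst (λ w → Unreceivable w a) (sym (buf≈ E s r))
                     (stuck s a q' (subst (λ z → Machine.Δ (S r) z (recv s r a) q') (st≈ E r) t))

  Reachable≈-avoids : (Bad : Config S → Set) → (∀ {c d} → c ≈ d → Bad d → Bad c)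
    → (∀ c → Reachable S c → ¬ Bad c) → ∀ {c} → Reachable≈ c → ¬ Bad c
  Reachable≈-avoids Bad resp free (d , r , E) bad = free d r (resp E bad)

  Reachable≈-progress : HasProgress S → ∀ {c} → Reachable≈ c → HasStep c ⊎ AllFinal S c
  Reachable≈-progress has-progress (d , r , E) with has-progress d r
  ... | inj₁ (d' , l , t) = inj₁ (d' , l , StepL-respˡ (≈-sym E) t)
  ... | inj₂ final = inj₂ (AllFinal-resp (≈-sym E) final)

  module Firing (_≟_ : DecidableEquality X) where
    private
      update-st : (c : Config S) (u : X) → Machine.Q (S u) → (p : X) → Machine.Q (S p)
      update-st c u q p with p ≟ u
      ... | yes refl = q
      ... | no _     = st c p

      update-st-here : ∀ c u q → update-st c u q u ≡ q
      update-st-here c u q with u ≟ u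
      ... | yes refl = refl
      ... | no u≢u   = ⊥-elim (u≢u refl)

      update-st-there : ∀ c u q p → p ≢ u → update-st c u q p ≡ st c p
      update-st-there c u q p p≢u with p ≟ u
      ... | yes p≡u = ⊥-elim (p≢u p≡u)
      ... | no _    = refl

      update-buf : (c : Config S) (s r : X) → List Msg → X → X → List Msg
      update-buf c s r w p q with p ≟ s | q ≟ r
      ... | yes _ | yes _ = w
      ... | _     | _     = buf c p q

      update-buf-here : ∀ c s r w → update-buf c s r w s r ≡ w
      update-buf-here c s r w with s ≟ s | r ≟ r
      ... | yes _   | yes _   = refl
      ... | no s≢s  | _       = ⊥-elim (s≢s refl)
      ... | yes _   | no r≢r  = ⊥-elim (r≢r refl)

      update-buf-there : ∀ c s r w p q → ¬ (p ≡ s × q ≡ r) → update-buf c s r w p q ≡ buf c p q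
      update-buf-there c s r w p q ne with p ≟ s | q ≟ r
      ... | yes p≡s | yes q≡r = ⊥-elim (ne (p≡s , q≡r))
      ... | yes _   | no _    = refl
      ... | no _    | _       = refl

      update : (c : Config S) (u : X) → Machine.Q (S u) → (s r : X) → List Msg → Config S
      update c u q s r w = record { st = update-st c u q ; buf = update-buf c s r w }

    send-enabled : ∀ {c s r a q} → Machine.Δ (S s) (st c s) (send s r a) q → HasStep c
    send-enabled {c} {s} {r} {a} {q} t = update c s q s r (buf c s r ++ [ a ]) , send s r a
      , subst (Machine.Δ (S s) (st c s) (send s r a)) (sym (update-st-here c s q)) t
      , update-st-there c s q
      , update-buf-here c s r _
      , update-buf-there c s r _

    recv-enabled : ∀ {c s r a q w} → Machine.Δ (S r) (st c r) (recv s r a) q → buf c s r ≡ a ∷ w → HasStep c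
    recv-enabled {c} {s} {r} {a} {q} {w} t buf-sr = update c r q s r w , recv s r a
      , subst (Machine.Δ (S r) (st c r) (recv s r a)) (sym (update-st-here c r q)) t
      , update-st-there c r q
      , trans buf-sr (cong (a ∷_) (sym (update-buf-here c s r w)))
      , update-buf-there c s r w

module _ {X : Set} where

  transportQ : {A B : Machine X} → A ≡ B → Machine.Q A → Machine.Q B
  transportQ = subst Machine.Q

  transport-Δ : {A B : Machine X} (e : A ≡ B) {q q' : Machine.Q A} {l : Act X}
    → Machine.Δ A q l q' → Machine.Δ B (transportQ e q) l (transportQ e q')
  transport-Δ refl t = t

  transport-q0 : {A B : Machine X} (e : A ≡ B) → transportQ e (Machine.q0 A) ≡ Machine.q0 B
  transport-q0 refl = refl

  transport-pred : (Φ : (A : Machine X) → Machine.Q A → Set) {A B : Machine X} (e : A ≡ B) {q : Machine.Q A}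
    → Φ A q → Φ B (transportQ e q)
  transport-pred Φ refl φ = φ

  transport-pred⁻ : (Φ : (A : Machine X) → Machine.Q A → Set) {A B : Machine X} (e : A ≡ B) {q : Machine.Q A}
    → Φ B (transportQ e q) → Φ A q
  transport-pred⁻ Φ refl φ = φ

IsInput-mapAct : {Y Z : Set} (f : Y → Z) (l : Act Y) → IsInput (mapAct f l) → IsInput l
IsInput-mapAct f (recv _ _ _) _ = tt

module Multicomposition {I : Set} (finI : Finite I) {P : I → Set} (dec : ∀ i → DecidableEquality (P i))
  (M : (i : I) → P i → CFSM (P i)) (cs : ∀ i → IsCommSystem (M i)) (h : (i : I) → P i)
  (CM : I → Msg → I → Set) (δ̇ : (i : I) → List (DTrans M h i)) (pol : IsConnectionPolicy M h CM δ̇) where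

  X : Set
  X = Σ I P

  _≟ᴵ_ : DecidableEquality I
  _≟ᴵ_ = Finite⇒≟ finI

  _≟ˣ_ : DecidableEquality X
  _≟ˣ_ = ≡-dec _≟ᴵ_ λ {i} → dec i

  S : System X
  S = multicomposition M h dec δ̇

  Sᵢ : (i : I) → System (P i)
  Sᵢ i = systemOf (M i)

  K : System I
  K = policySystem M h δ̇

  Qh : I → Set
  Qh i = CFSM.Q (Mh M h i)

  δh : (i : I) → List (Qh i × Act (P i) × Qh i)
  δh i = CFSM.δ (Mh M h i)

  GS : I → Set
  GS i = GState M h δ̇ i

  G : I → Machine X
  G i = gateway M h δ̇ i

  NoMixed : Set
  NoMixed = ∀ i q → ¬ Mixed ⟦ Mh M h i ⟧ q

  open Firing {S = S} _≟ˣ_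

  named : ∀ i x {q l q'} → (q , l , q') ∈ CFSM.δ (M i x) → subject l ≡ x × ValidChannel l
  named i x = proj₂ (cs i) x

  send-channel : ∀ {i x q y a q'} → (q , send x y a , q') ∈ CFSM.δ (M i x) → x ≢ y
  send-channel {i} {x} t = proj₂ (named i x t)

  recv-channel : ∀ {i x q y a q'} → (q , recv y x a , q') ∈ CFSM.δ (M i x) → y ≢ x
  recv-channel {i} {x} t = proj₂ (named i x t)

  interface-≡ : ∀ {j i} {x : P i} → _≡_ {A = X} (j , h j) (i , x) → x ≡ h i
  interface-≡ refl = refl

  policy-for-input : ∀ i {q r a q'} → (q , recv r (h i) a , q') ∈ δh i → ∃ λ j → (q , send i j a , q') ∈ δ̇ i
  policy-for-input i t with proj₁ (pol i) t
  ... | j , _ , m , _ = j , m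

  policy-for-output : ∀ i {q r a q'} → (q , send (h i) r a , q') ∈ δh i → ∃ λ j → (q , recv j i a , q') ∈ δ̇ i
  policy-for-output i t with proj₁ (proj₂ (pol i)) t
  ... | j , _ , m , _ = j , m

  Justified : ∀ i → DTrans M h i → Set
  Justified i (q , send i' j a , q') = i' ≡ i × j ≢ i × ∃ λ r → (q , recv r (h i) a , q') ∈ δh i
  Justified i (q , recv j i' a , q') = i' ≡ i × j ≢ i × ∃ λ s → (q , send (h i) s a , q') ∈ δh i

  -- Minimality of δ̇, applied to its justified part, which already satisfies (*) and (**).
  policy-justified : ∀ i {t} → t ∈ δ̇ i → Justified i t
  policy-justified i m = proj₂ (proj₂ (proj₂ (pol i)) R proj₁ star starstar m)
    where
      R : DTrans M h i → Set
      R t = t ∈ δ̇ i × Justified i t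
      star : CondStar M h CM i R
      star {r = r} t with proj₁ (pol i) t
      ... | j , j≢i , m , cm = j , j≢i , (m , refl , j≢i , r , t) , cm
      starstar : CondStarStar M h CM i R
      starstar {r = r} t with proj₁ (proj₂ (pol i)) t
      ... | j , j≢i , m , cm = j , j≢i , (m , refl , j≢i , r , t) , cm

  justifying-input : ∀ i {q j a q'} → (q , send i j a , q') ∈ δ̇ i → ∃ λ r → (q , recv r (h i) a , q') ∈ δh i
  justifying-input i m = proj₂ (proj₂ (policy-justified i m))

  justifying-output : ∀ i {q j a q'} → (q , recv j i a , q') ∈ δ̇ i → ∃ λ s → (q , send (h i) s a , q') ∈ δh i
  justifying-output i m = proj₂ (proj₂ (policy-justified i m))

  S-gateway : ∀ i → S (i , h i) ≡ G i
  S-gateway i with dec i (h i) (h i)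
  ... | yes _ = refl
  ... | no h≢h = ⊥-elim (h≢h refl)

  S-local : ∀ i x → x ≢ h i → S (i , x) ≡ liftMachine M h i ⟦ M i x ⟧
  S-local i x x≢h with dec i x (h i)
  ... | yes x≡h = ⊥-elim (x≢h x≡h)
  ... | no _ = refl

  toG : ∀ i → Machine.Q (S (i , h i)) → GS i
  toG i = transportQ (S-gateway i)

  fromG : ∀ i → GS i → Machine.Q (S (i , h i))
  fromG i = transportQ (sym (S-gateway i))

  toL : ∀ i x → x ≢ h i → Machine.Q (S (i , x)) → CFSM.Q (M i x)
  toL i x x≢h = transportQ (S-local i x x≢h)

  fromL : ∀ i x → x ≢ h i → CFSM.Q (M i x) → Machine.Q (S (i , x))
  fromL i x x≢h = transportQ (sym (S-local i x x≢h))

  toL-irrelevant : ∀ i x (ne ne' : x ≢ h i) q → toL i x ne q ≡ toL i x ne' q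
  toL-irrelevant i x ne ne' q = cong (λ e → transportQ e q) (uip (S-local i x ne) (S-local i x ne'))

  -- Midway through relaying (q , l , q'), the side that has already taken part in l sees q', the other q:
  -- for an output of M_h the policy side, for an input the local side.
  localView : ∀ i → GS i → Qh i
  localView i (inj₁ q) = q
  localView i (inj₂ (q , send _ _ _ , q')) = q
  localView i (inj₂ (q , recv _ _ _ , q')) = q'

  policyView : ∀ i → GS i → Qh i
  policyView i (inj₁ q) = q
  policyView i (inj₂ (q , send _ _ _ , q')) = q'
  policyView i (inj₂ (q , recv _ _ _ , q')) = q

  gwState : Config S → (i : I) → GS i
  gwState c i = toG i (st c (i , h i))

  localState' : Config S → (i : I) (x : P i) → Dec (x ≡ h i) → CFSM.Q (M i x)
  localState' c i x (yes refl) = localView i (gwState c i)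
  localState' c i x (no x≢h) = toL i x x≢h (st c (i , x))

  localState : Config S → (i : I) (x : P i) → CFSM.Q (M i x)
  localState c i x = localState' c i x (dec i x (h i))

  localState-elim : ∀ {c i} (Φ : (x : P i) → CFSM.Q (M i x) → Set)
    → Φ (h i) (localView i (gwState c i)) → (∀ x (x≢h : x ≢ h i) → Φ x (toL i x x≢h (st c (i , x))))
    → ∀ x → Φ x (localState c i x)
  localState-elim {c} {i} Φ at-h elsewhere x = by-cases (dec i x (h i))
    where
      by-cases : (d : Dec (x ≡ h i)) → Φ x (localState' c i x d)
      by-cases (yes refl) = at-h
      by-cases (no x≢h) = elsewhere x x≢h

  localState-h : ∀ c i → localState c i (h i) ≡ localView i (gwState c i)
  localState-h c i = by-cases (dec i (h i) (h i))
    where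
      by-cases : (d : Dec (h i ≡ h i)) → localState' c i (h i) d ≡ localView i (gwState c i)
      by-cases (yes refl) = refl
      by-cases (no h≢h) = ⊥-elim (h≢h refl)

  localState-≢ : ∀ c i x (x≢h : x ≢ h i) → localState c i x ≡ toL i x x≢h (st c (i , x))
  localState-≢ c i x x≢h = by-cases (dec i x (h i))
    where
      by-cases : (d : Dec (x ≡ h i)) → localState' c i x d ≡ toL i x x≢h (st c (i , x))
      by-cases (yes x≡h) = ⊥-elim (x≢h x≡h)
      by-cases (no x≢h') = toL-irrelevant i x x≢h' x≢h _

  localState-gw : ∀ {c i g} → gwState c i ≡ g → localState c i (h i) ≡ localView i g
  localState-gw {c} {i} e = trans (localState-h c i) (cong (localView i) e)

  localState-unchanged : ∀ c c' i x → st c' (i , x) ≡ st c (i , x) → localState c' i x ≡ localState c i x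
  localState-unchanged c c' i x e = by-cases (dec i x (h i))
    where
      by-cases : (d : Dec (x ≡ h i)) → localState' c' i x d ≡ localState' c i x d
      by-cases (yes refl) = cong (λ z → localView i (toG i z)) e
      by-cases (no x≢h) = cong (toL i x x≢h) e

  toSᵢ : Config S → (i : I) → Config (Sᵢ i)
  toSᵢ c i = record { st = localState c i ; buf = λ x y → buf c (i , x) (i , y) }

  toK : Config S → Config K
  toK c = record { st = λ i → policyView i (gwState c i) ; buf = λ i j → buf c (i , h i) (j , h j) }

  policy-at-idle : ∀ c {i q l q'} → gwState c i ≡ inj₁ q
    → (policyView i (gwState c i) , l , q') ∈ δ̇ i → (q , l , q') ∈ δ̇ i
  policy-at-idle c {i} {l = l} {q'} idle = subst (λ z → (z , l , q') ∈ δ̇ i) (cong (policyView i) idle)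

  Live : ∀ i → GS i → Set
  Live i (inj₁ _) = ⊤
  Live i (inj₂ t) = ∃ λ l → ∃ λ g' → GΔ M h δ̇ i (inj₂ t) l g'

  OnlyInterfacesCross : Config S → Set
  OnlyInterfacesCross c = ∀ i x j y → i ≢ j → buf c (i , x) (j , y) ≡ [] ⊎ (x ≡ h i × y ≡ h j)

  record Invariant (c : Config S) : Set where
    field
      reach-Sᵢ : ∀ i → Reachable≈ (toSᵢ c i)
      reach-K  : Reachable≈ (toK c)
      cross    : OnlyInterfacesCross c
      live     : ∀ i → Live i (gwState c i)
  open Invariant

  invariant-initial : Invariant (initial S)
  invariant-initial = record
    { reach-Sᵢ = λ i → initial (Sᵢ i) , ε , record { st≈ = initial-local i ; buf≈ = λ _ _ → refl }
    ; reach-K  = initial K , ε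
               , record { st≈ = λ i → cong (policyView i) (sym (transport-q0 (S-gateway i)))
                        ; buf≈ = λ _ _ → refl }
    ; cross    = λ _ _ _ _ _ → inj₁ refl
    ; live     = λ i → subst (Live i) (sym (transport-q0 (S-gateway i))) tt }
    where
      initial-local : ∀ i x → CFSM.q0 (M i x) ≡ localState (initial S) i x
      initial-local i = localState-elim (λ x q → CFSM.q0 (M i x) ≡ q)
        (cong (localView i) (sym (transport-q0 (S-gateway i))))
        (λ x x≢h → sym (transport-q0 (S-local i x x≢h)))

  record Frame (c c' : Config S) (u s r : X) : Set where
    field
      st-frame  : ∀ p → p ≢ u → st c' p ≡ st c p
      buf-frame : ∀ p q → ¬ (p ≡ s × q ≡ r) → buf c' p q ≡ buf c p q
  open Frame

  module _ {c c' : Config S} where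

    gwState-frame : ∀ {u s r} → Frame c c' u s r → ∀ j → (j , h j) ≢ u → gwState c' j ≡ gwState c j
    gwState-frame F j ne = cong (toG j) (st-frame F _ ne)

    reach-Sᵢ-untouched : ∀ {u s r} → Frame c c' u s r → (s ≡ u ⊎ r ≡ u)
      → ∀ k → k ≢ proj₁ u → Reachable≈ (toSᵢ c k) → Reachable≈ (toSᵢ c' k)
    reach-Sᵢ-untouched {u} {s} {r} F on-u k k≢u = Reachable≈-unchanged
      (λ x → localState-unchanged c c' k x (st-frame F _ (λ e → k≢u (,-injectiveˡ e))))
      (λ x y → buf-frame F _ _ (off-channel on-u x y))
      where
        off-channel : (s ≡ u ⊎ r ≡ u) → ∀ x y → ¬ ((k , x) ≡ s × (k , y) ≡ r)
        off-channel (inj₁ refl) x y (e , _) = k≢u (,-injectiveˡ e)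
        off-channel (inj₂ refl) x y (_ , e) = k≢u (,-injectiveˡ e)

    cross-preserved : ∀ {u s r} → Frame c c' u s r → OnlyInterfacesCross c
      → (proj₁ s ≡ proj₁ r ⊎ (proj₂ s ≡ h (proj₁ s) × proj₂ r ≡ h (proj₁ r))) → OnlyInterfacesCross c'
    cross-preserved {u} {s} {r} F C ok i x j y i≢j with (i , x) ≟ˣ s | (j , y) ≟ˣ r
    ... | yes refl | yes refl = step-channel ok
      where
        step-channel : (i ≡ j ⊎ (x ≡ h i × y ≡ h j)) → buf c' (i , x) (j , y) ≡ [] ⊎ (x ≡ h i × y ≡ h j)
        step-channel (inj₁ i≡j) = ⊥-elim (i≢j i≡j)
        step-channel (inj₂ interfaces) = inj₂ interfaces
    ... | no ne | _ = subst (λ w → w ≡ [] ⊎ (x ≡ h i × y ≡ h j))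
                        (sym (buf-frame F _ _ (λ { (e , _) → ne e }))) (C i x j y i≢j)
    ... | yes _ | no ne = subst (λ w → w ≡ [] ⊎ (x ≡ h i × y ≡ h j))
                            (sym (buf-frame F _ _ (λ { (_ , e) → ne e }))) (C i x j y i≢j)

    toSᵢ-send : ∀ {i x y a} → Frame c c' (i , x) (i , x) (i , y)
      → (localState c i x , send x y a , localState c' i x) ∈ CFSM.δ (M i x)
      → buf c' (i , x) (i , y) ≡ buf c (i , x) (i , y) ++ [ a ]
      → _⟶_ (Sᵢ i) (toSᵢ c i) (toSᵢ c' i)
    toSᵢ-send {i} {x} {y} {a} F t grow = send x y a , t
      , (λ x' ne → localState-unchanged c c' i x' (st-frame F _ (λ { refl → ne refl })))
      , grow
      , (λ x' y' ne → buf-frame F _ _ (λ { (refl , refl) → ne (refl , refl) }))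

    toSᵢ-recv : ∀ {i x y a} → Frame c c' (i , x) (i , y) (i , x)
      → (localState c i x , recv y x a , localState c' i x) ∈ CFSM.δ (M i x)
      → buf c (i , y) (i , x) ≡ a ∷ buf c' (i , y) (i , x)
      → _⟶_ (Sᵢ i) (toSᵢ c i) (toSᵢ c' i)
    toSᵢ-recv {i} {x} {y} {a} F t shrink = recv y x a , t
      , (λ x' ne → localState-unchanged c c' i x' (st-frame F _ (λ { refl → ne refl })))
      , shrink
      , (λ x' y' ne → buf-frame F _ _ (λ { (refl , refl) → ne (refl , refl) }))

    toK-send : ∀ {i j a} → Frame c c' (i , h i) (i , h i) (j , h j)
      → (policyView i (gwState c i) , send i j a , policyView i (gwState c' i)) ∈ δ̇ i
      → buf c' (i , h i) (j , h j) ≡ buf c (i , h i) (j , h j) ++ [ a ]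
      → _⟶_ K (toK c) (toK c')
    toK-send {i} {j} {a} F m grow = send i j a , m
      , (λ p ne → cong (policyView p) (gwState-frame F p (λ e → ne (,-injectiveˡ e))))
      , grow
      , (λ p q ne → buf-frame F _ _ (λ { (e , e') → ne (,-injectiveˡ e , ,-injectiveˡ e') }))

    toK-recv : ∀ {i j a} → Frame c c' (i , h i) (j , h j) (i , h i)
      → (policyView i (gwState c i) , recv j i a , policyView i (gwState c' i)) ∈ δ̇ i
      → buf c (j , h j) (i , h i) ≡ a ∷ buf c' (j , h j) (i , h i)
      → _⟶_ K (toK c) (toK c')
    toK-recv {i} {j} {a} F m shrink = recv j i a , m
      , (λ p ne → cong (policyView p) (gwState-frame F p (λ e → ne (,-injectiveˡ e))))
      , shrink
      , (λ p q ne → buf-frame F _ _ (λ { (e , e') → ne (,-injectiveˡ e , ,-injectiveˡ e') }))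

  module _ {c c' : Config S} {i : I} {s r : X} (F : Frame c c' (i , h i) s r) where

    localState-gateway-step : localView i (gwState c' i) ≡ localView i (gwState c i)
      → ∀ x → localState c' i x ≡ localState c i x
    localState-gateway-step e x = by-cases (dec i x (h i))
      where
        by-cases : (d : Dec (x ≡ h i)) → localState' c' i x d ≡ localState' c i x d
        by-cases (yes refl) = e
        by-cases (no x≢h) = cong (toL i x x≢h) (st-frame F _ (λ { refl → x≢h refl }))

    policyView-gateway-step : policyView i (gwState c' i) ≡ policyView i (gwState c i)
      → ∀ j → policyView j (gwState c' j) ≡ policyView j (gwState c j)
    policyView-gateway-step e j with j ≟ᴵ i
    ... | yes refl = e
    ... | no j≢i = cong (policyView j) (gwState-frame F j (λ eq → j≢i (,-injectiveˡ eq)))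

    live-gateway-step : Live i (gwState c' i) → Invariant c → ∀ j → Live j (gwState c' j)
    live-gateway-step now V j with j ≟ᴵ i
    ... | yes refl = now
    ... | no j≢i = subst (Live j) (sym (gwState-frame F j (λ eq → j≢i (,-injectiveˡ eq)))) (live V j)

  -- A gateway state is a transport of st c (i , h i), so its transitions are matched with abstracted endpoints g, g'.
  module GatewayStep {c c' : Config S} {i : I} {g g' : GS i} (e : gwState c i ≡ g) (e' : gwState c' i ≡ g') where

    on-local : ∀ {l} → (localView i g , l , localView i g') ∈ δh i
      → (localState c i (h i) , l , localState c' i (h i)) ∈ δh i
    on-local {l} = subst₂ (λ z z' → (z , l , z') ∈ δh i) (sym (localState-gw e)) (sym (localState-gw e'))

    on-policy : ∀ {l} → (policyView i g , l , policyView i g') ∈ δ̇ i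
      → (policyView i (gwState c i) , l , policyView i (gwState c' i)) ∈ δ̇ i
    on-policy {l} =
      subst₂ (λ z z' → (z , l , z') ∈ δ̇ i) (sym (cong (policyView i) e)) (sym (cong (policyView i) e'))

    view-unchanged : (view : GS i → Qh i) → view g' ≡ view g → view (gwState c' i) ≡ view (gwState c i)
    view-unchanged view same = trans (cong view e') (trans same (sym (cong view e)))

    invariant-gateway-send : ∀ {r a} → Frame c c' (i , h i) (i , h i) r
      → buf c' (i , h i) r ≡ buf c (i , h i) r ++ [ a ] → Invariant c
      → GΔ M h δ̇ i g (send (i , h i) r a) g' → Invariant c'
    invariant-gateway-send F grow V (out₂ t m) = record
      { reach-Sᵢ = reach
      ; reach-K  = Reachable≈-unchanged (policyView-gateway-step F (view-unchanged (policyView i) refl))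
                     (λ _ _ → buf-frame F _ _ λ { (_ , eq) → send-channel t (sym (interface-≡ eq)) }) (reach-K V)
      ; cross    = cross-preserved F (cross V) (inj₁ refl)
      ; live     = live-gateway-step F (subst (Live i) (sym e') tt) V }
      where
        reach : ∀ k → Reachable≈ (toSᵢ c' k)
        reach k with k ≟ᴵ i
        ... | yes refl = Reachable≈-step (toSᵢ-send F (on-local t) grow) (reach-Sᵢ V i)
        ... | no k≢i = reach-Sᵢ-untouched F (inj₁ refl) k k≢i (reach-Sᵢ V k)
    invariant-gateway-send F grow V (in₂ {j = j} t m) = record
      { reach-Sᵢ = reach
      ; reach-K  = Reachable≈-step (toK-send F (on-policy m) grow) (reach-K V)
      ; cross    = cross-preserved F (cross V) (inj₂ (refl , refl))
      ; live     = live-gateway-step F (subst (Live i) (sym e') tt) V }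
      where
        j≢i : j ≢ i
        j≢i = proj₁ (proj₂ (policy-justified i m))
        reach : ∀ k → Reachable≈ (toSᵢ c' k)
        reach k with k ≟ᴵ i
        ... | yes refl = Reachable≈-unchanged (localState-gateway-step F (view-unchanged (localView i) refl))
                           (λ _ _ → buf-frame F _ _ λ { (_ , eq) → j≢i (sym (,-injectiveˡ eq)) }) (reach-Sᵢ V i)
        ... | no k≢i = reach-Sᵢ-untouched F (inj₁ refl) k k≢i (reach-Sᵢ V k)

    invariant-gateway-recv : ∀ {s a} → Frame c c' (i , h i) s (i , h i)
      → buf c s (i , h i) ≡ a ∷ buf c' s (i , h i) → Invariant c
      → GΔ M h δ̇ i g (recv s (i , h i) a) g' → Invariant c'
    invariant-gateway-recv {a = a} F shrink V (out₁ {s = s} {q' = q'} {j = j} t m) = record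
      { reach-Sᵢ = reach
      ; reach-K  = Reachable≈-step (toK-recv F (on-policy m) shrink) (reach-K V)
      ; cross    = cross-preserved F (cross V) (inj₂ (refl , refl))
      ; live     = live-gateway-step F
                     (subst (Live i) (sym e') (send (i , h i) (i , s) a , inj₁ q' , out₂ t m)) V }
      where
        j≢i : j ≢ i
        j≢i = proj₁ (proj₂ (policy-justified i m))
        reach : ∀ k → Reachable≈ (toSᵢ c' k)
        reach k with k ≟ᴵ i
        ... | yes refl = Reachable≈-unchanged (localState-gateway-step F (view-unchanged (localView i) refl))
                           (λ _ _ → buf-frame F _ _ λ { (eq , _) → j≢i (sym (,-injectiveˡ eq)) }) (reach-Sᵢ V i)
        ... | no k≢i = reach-Sᵢ-untouched F (inj₂ refl) k k≢i (reach-Sᵢ V k)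
    invariant-gateway-recv {a = a} F shrink V (in₁ {q' = q'} {j = j} t m) = record
      { reach-Sᵢ = reach
      ; reach-K  = Reachable≈-unchanged (policyView-gateway-step F (view-unchanged (policyView i) refl))
                     (λ _ _ → buf-frame F _ _ λ { (eq , _) → recv-channel t (interface-≡ eq) }) (reach-K V)
      ; cross    = cross-preserved F (cross V) (inj₁ refl)
      ; live     = live-gateway-step F
                     (subst (Live i) (sym e') (send (i , h i) (j , h j) a , inj₁ q' , in₂ t m)) V }
      where
        reach : ∀ k → Reachable≈ (toSᵢ c' k)
        reach k with k ≟ᴵ i
        ... | yes refl = Reachable≈-step (toSᵢ-recv F (on-local t) shrink) (reach-Sᵢ V i)
        ... | no k≢i = reach-Sᵢ-untouched F (inj₂ refl) k k≢i (reach-Sᵢ V k)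

  module _ {c c' : Config S} {i : I} {x : P i} (x≢h : x ≢ h i) where

    on-local-machine : ∀ {l} → (toL i x x≢h (st c (i , x)) , l , toL i x x≢h (st c' (i , x))) ∈ CFSM.δ (M i x)
      → (localState c i x , l , localState c' i x) ∈ CFSM.δ (M i x)
    on-local-machine {l} = subst₂ (λ z z' → (z , l , z') ∈ CFSM.δ (M i x))
      (sym (localState-≢ c i x x≢h)) (sym (localState-≢ c' i x x≢h))

    invariant-local-step : ∀ {s r} → Frame c c' (i , x) s r → (s ≡ (i , x) ⊎ r ≡ (i , x)) → proj₁ s ≡ proj₁ r
      → Reachable≈ (toSᵢ c' i) → Invariant c → Invariant c'
    invariant-local-step {s} {r} F on-x internal reach-i V = record
      { reach-Sᵢ = reach
      ; reach-K  = Reachable≈-unchanged (λ j → cong (policyView j) (gwState-untouched j))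
                     (λ _ _ → buf-frame F _ _ (not-gateway-channel on-x)) (reach-K V)
      ; cross    = cross-preserved F (cross V) (inj₁ internal)
      ; live     = λ j → subst (Live j) (sym (gwState-untouched j)) (live V j) }
      where
        gwState-untouched : ∀ j → gwState c' j ≡ gwState c j
        gwState-untouched j = gwState-frame F j (λ eq → x≢h (interface-≡ eq))
        not-gateway-channel : (s ≡ (i , x) ⊎ r ≡ (i , x)) → ∀ {j j'} → ¬ ((j , h j) ≡ s × (j' , h j') ≡ r)
        not-gateway-channel (inj₁ refl) (eq , _) = x≢h (interface-≡ eq)
        not-gateway-channel (inj₂ refl) (_ , eq) = x≢h (interface-≡ eq)
        reach : ∀ k → Reachable≈ (toSᵢ c' k)
        reach k with k ≟ᴵ i
        ... | yes refl = reach-i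
        ... | no k≢i = reach-Sᵢ-untouched F on-x k k≢i (reach-Sᵢ V k)

  invariant-send : ∀ {c c' i x r a} → Dec (x ≡ h i) → Frame c c' (i , x) (i , x) r
    → buf c' (i , x) r ≡ buf c (i , x) r ++ [ a ] → Invariant c
    → Machine.Δ (S (i , x)) (st c (i , x)) (send (i , x) r a) (st c' (i , x)) → Invariant c'
  invariant-send {i = i} (yes refl) F grow V T =
    GatewayStep.invariant-gateway-send refl refl F grow V (transport-Δ (S-gateway i) T)
  invariant-send {i = i} {x} (no x≢h) F grow V T with transport-Δ (S-local i x x≢h) T
  ... | send _ _ _ , t , refl = invariant-local-step x≢h F (inj₁ refl) refl
                                  (Reachable≈-step (toSᵢ-send F (on-local-machine x≢h t) grow) (reach-Sᵢ V i)) V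
  ... | recv _ _ _ , _ , ()

  invariant-recv : ∀ {c c' i x s a} → Dec (x ≡ h i) → Frame c c' (i , x) s (i , x)
    → buf c s (i , x) ≡ a ∷ buf c' s (i , x) → Invariant c
    → Machine.Δ (S (i , x)) (st c (i , x)) (recv s (i , x) a) (st c' (i , x)) → Invariant c'
  invariant-recv {i = i} (yes refl) F shrink V T =
    GatewayStep.invariant-gateway-recv refl refl F shrink V (transport-Δ (S-gateway i) T)
  invariant-recv {i = i} {x} (no x≢h) F shrink V T with transport-Δ (S-local i x x≢h) T
  ... | recv _ _ _ , t , refl = invariant-local-step x≢h F (inj₂ refl) refl
                                  (Reachable≈-step (toSᵢ-recv F (on-local-machine x≢h t) shrink) (reach-Sᵢ V i)) V
  ... | send _ _ _ , _ , ()

  invariant-step : ∀ {c c'} → _⟶_ S c c' → Invariant c → Invariant c'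
  invariant-step (send (i , x) r a , T , st-frame , grow , buf-frame) V =
    invariant-send (dec i x (h i)) (record { st-frame = st-frame ; buf-frame = buf-frame }) grow V T
  invariant-step (recv s (i , x) a , T , st-frame , shrink , buf-frame) V =
    invariant-recv (dec i x (h i)) (record { st-frame = st-frame ; buf-frame = buf-frame }) shrink V T

  invariant-reachable : ∀ {c} → Reachable S c → Invariant c
  invariant-reachable = go invariant-initial
    where
      go : ∀ {c c'} → Invariant c → Star (_⟶_ S) c c' → Invariant c'
      go V ε = V
      go V (step ◅ steps) = go (invariant-step step V) steps

  final-Mh⇒G : ∀ i {q} → Final ⟦ Mh M h i ⟧ q → Final (G i) (inj₁ q)
  final-Mh⇒G i final _ _ (out₁ t _) = final _ _ t
  final-Mh⇒G i final _ _ (in₁ t _) = final _ _ t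

  final-G⇒Mh : ∀ i {q} → Final (G i) (inj₁ q) → Final ⟦ Mh M h i ⟧ q
  final-G⇒Mh i final (send _ _ _) _ t with named i (h i) t
  ... | refl , _ = final _ _ (out₁ t (proj₂ (policy-for-output i t)))
  final-G⇒Mh i final (recv _ _ _) _ t with named i (h i) t
  ... | refl , _ = final _ _ (in₁ t (proj₂ (policy-for-input i t)))

  final-Mh⇒K : ∀ i {q} → Final ⟦ Mh M h i ⟧ q → Final (K i) q
  final-Mh⇒K i final (send _ _ _) _ m with policy-justified i m
  ... | refl , _ , _ , t = final _ _ t
  final-Mh⇒K i final (recv _ _ _) _ m with policy-justified i m
  ... | refl , _ , _ , t = final _ _ t

  final-K⇒Mh : ∀ i {q} → Final (K i) q → Final ⟦ Mh M h i ⟧ q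
  final-K⇒Mh i final (send _ _ _) _ t with named i (h i) t
  ... | refl , _ = final _ _ (proj₂ (policy-for-output i t))
  final-K⇒Mh i final (recv _ _ _) _ t with named i (h i) t
  ... | refl , _ = final _ _ (proj₂ (policy-for-input i t))

  final-live-idle : ∀ i g → Live i g → Final (G i) g → ∃ λ q → g ≡ inj₁ q × Final ⟦ Mh M h i ⟧ q
  final-live-idle i (inj₁ q) _ final = q , refl , final-G⇒Mh i final
  final-live-idle i (inj₂ _) (l , g' , T) final = ⊥-elim (final l g' T)

  receiving-gateway-idle : ∀ i g → Receiving (G i) g → ∃ λ q → g ≡ inj₁ q × ¬ Final ⟦ Mh M h i ⟧ q
  receiving-gateway-idle i (inj₁ q) (not-final , _) = q , refl , λ final → not-final (final-Mh⇒G i final)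
  receiving-gateway-idle i (inj₂ t) (not-final , inputs) =
    ⊥-elim (not-final λ l g' T → midway-outputs-only T (inputs l g' T))
    where
      midway-outputs-only : ∀ {l g'} → GΔ M h δ̇ i (inj₂ t) l g' → ¬ IsInput l
      midway-outputs-only (out₂ _ _) ()
      midway-outputs-only (in₂ _ _) ()

  final-local⇒S : ∀ i x (x≢h : x ≢ h i) {q} → Final ⟦ M i x ⟧ (toL i x x≢h q) → Final (S (i , x)) q
  final-local⇒S i x x≢h final = transport-pred⁻ Final (S-local i x x≢h) λ _ q' (l₀ , t , _) → final l₀ q' t

  final-S⇒local : ∀ i x (x≢h : x ≢ h i) {q} → Final (S (i , x)) q → Final ⟦ M i x ⟧ (toL i x x≢h q)
  final-S⇒local i x x≢h final l₀ q' t = transport-pred Final (S-local i x x≢h) final _ q' (l₀ , t , refl)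

  receiving-S⇒local : ∀ i x (x≢h : x ≢ h i) {q} → Receiving (S (i , x)) q → Receiving ⟦ M i x ⟧ (toL i x x≢h q)
  receiving-S⇒local i x x≢h R with transport-pred Receiving (S-local i x x≢h) R
  ... | not-final , inputs = (λ final → not-final λ _ q' (l₀ , t , _) → final l₀ q' t)
                           , λ l₀ q' t → IsInput-mapAct (i ,_) l₀ (inputs _ q' (l₀ , t , refl))

  local⇒S-Δ : ∀ (c : Config S) i x (x≢h : x ≢ h i) {l₀ q'}
    → (toL i x x≢h (st c (i , x)) , l₀ , q') ∈ CFSM.δ (M i x)
    → Machine.Δ (S (i , x)) (st c (i , x)) (mapAct (i ,_) l₀) (fromL i x x≢h q')
  local⇒S-Δ c i x x≢h {l₀} {q'} t =
    subst (λ z → Machine.Δ (S (i , x)) z (mapAct (i ,_) l₀) (fromL i x x≢h q'))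
      (subst-sym-subst (S-local i x x≢h)) (transport-Δ (sym (S-local i x x≢h)) (l₀ , t , refl))

  gateway⇒S-Δ : ∀ (c : Config S) i {g l g'} → gwState c i ≡ g → GΔ M h δ̇ i g l g'
    → Machine.Δ (S (i , h i)) (st c (i , h i)) l (fromG i g')
  gateway⇒S-Δ c i {l = l} {g'} refl T =
    subst (λ z → Machine.Δ (S (i , h i)) z l (fromG i g'))
      (subst-sym-subst (S-gateway i)) (transport-Δ (sym (S-gateway i)) T)

  gateways-idle-final : ∀ {c} → Invariant c → AllFinal S c
    → ∀ i → ∃ λ q → gwState c i ≡ inj₁ q × Final ⟦ Mh M h i ⟧ q
  gateways-idle-final {c} V final i =
    final-live-idle i (gwState c i) (live V i) (transport-pred Final (S-gateway i) (final (i , h i)))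

  allFinal-toSᵢ : ∀ {c} → Invariant c → AllFinal S c → ∀ i → AllFinal (Sᵢ i) (toSᵢ c i)
  allFinal-toSᵢ {c} V final i = localState-elim (λ x → Final ⟦ M i x ⟧)
    (let q , idle , final-q = gateways-idle-final V final i in
     subst (Final ⟦ Mh M h i ⟧) (sym (cong (localView i) idle)) final-q)
    (λ x x≢h → final-S⇒local i x x≢h (final (i , x)))

  allFinal-toK : ∀ {c} → Invariant c → AllFinal S c → AllFinal K (toK c)
  allFinal-toK V final i =
    let q , idle , final-q = gateways-idle-final V final i in
    subst (Final (K i)) (sym (cong (policyView i) idle)) (final-Mh⇒K i final-q)

  orphanMessageFree-transfer : (∀ i → OrphanMessageFree (Sᵢ i)) → OrphanMessageFree K → OrphanMessageFree S
  orphanMessageFree-transfer free-Sᵢ free-K c reach (final , (i , x) , (j , y) , xy≢ , pending)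
    with invariant-reachable reach | i ≟ᴵ j
  ... | V | yes refl = Reachable≈-avoids (OrphanMessage (Sᵢ i)) OrphanMessage-resp (free-Sᵢ i) (reach-Sᵢ V i)
                         (allFinal-toSᵢ V final i , x , y , (λ x≡y → xy≢ (cong (i ,_) x≡y)) , pending)
  ... | V | no i≢j with cross V i x j y i≢j
  ...   | inj₁ empty = pending empty
  ...   | inj₂ (refl , refl) = Reachable≈-avoids (OrphanMessage K) OrphanMessage-resp free-K (reach-K V)
                                 (allFinal-toK V final , i , j , i≢j , pending)

  gateway-receiving : ∀ c → (∀ p → Receiving (S p) (st c p)) → ∀ i → Receiving (G i) (gwState c i)
  gateway-receiving _ receiving i = transport-pred Receiving (S-gateway i) (receiving (i , h i))

  deadlock-K : ∀ {c} → Deadlock S c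
    → (∀ i {q l q'} → gwState c i ≡ inj₁ q → (q , l , q') ∈ δh i → ¬ IsInput l) → Deadlock K (toK c)
  deadlock-K {c} (empty , receiving) no-input =
    (λ i j i≢j → empty _ _ (λ e → i≢j (,-injectiveˡ e))) , receiving-K
    where
      receiving-K : ∀ i → Receiving (K i) (policyView i (gwState c i))
      receiving-K i with receiving-gateway-idle i (gwState c i) (gateway-receiving c receiving i)
      ... | q , idle , not-final =
        subst (Receiving (K i)) (sym (cong (policyView i) idle))
          ((λ final → not-final (final-K⇒Mh i final)) , inputs)
        where
          inputs : ∀ l q' → (q , l , q') ∈ δ̇ i → IsInput l
          inputs (recv _ _ _) _ _ = tt
          inputs (send _ _ _) _ m with policy-justified i m
          ... | refl , _ , _ , t = ⊥-elim (no-input i idle t tt)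

  module _ (no-mixed : NoMixed) where

    receiving-Mh : ∀ i {q l q'} → ¬ Final ⟦ Mh M h i ⟧ q → (q , l , q') ∈ δh i → IsInput l → Receiving ⟦ Mh M h i ⟧ q
    receiving-Mh i {q} {l} {q'} not-final t input = not-final , inputs
      where
        inputs : ∀ l' q'' → (q , l' , q'') ∈ δh i → IsInput l'
        inputs (recv _ _ _) _ _ = tt
        inputs (send _ _ _) q'' t' = ⊥-elim (no-mixed i q ((_ , q'' , t' , tt) , (l , q' , t , input)))

    deadlock-Sᵢ : ∀ {c} → Deadlock S c
      → ∀ i {q l q'} → gwState c i ≡ inj₁ q → (q , l , q') ∈ δh i → IsInput l → Deadlock (Sᵢ i) (toSᵢ c i)
    deadlock-Sᵢ {c} (empty , receiving) i idle t input =
      (λ x y x≢y → empty (i , x) (i , y) λ { refl → x≢y refl }) , localState-elim (λ x → Receiving ⟦ M i x ⟧)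
        (subst (λ g → Receiving ⟦ Mh M h i ⟧ (localView i g)) (sym idle) (receiving-Mh i not-final t input))
        (λ x x≢h → receiving-S⇒local i x x≢h (receiving (i , x)))
      where
        not-final : ¬ Final ⟦ Mh M h i ⟧ _
        not-final final =
          proj₁ (subst (Receiving (G i)) idle (gateway-receiving c receiving i)) (final-Mh⇒G i final)

    -- Either some idle interface offers an input, and S_i is deadlocked, or none does, and 𝕂 is.
    deadlockFree-transfer : (∀ i → DeadlockFree (Sᵢ i)) → DeadlockFree K → DeadlockFree S
    deadlockFree-transfer free-Sᵢ free-K c reach deadlock = K-avoids λ i idle t input →
      Reachable≈-avoids (Deadlock (Sᵢ i)) Deadlock-resp (free-Sᵢ i) (reach-Sᵢ V i)
        (deadlock-Sᵢ deadlock i idle t input)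
      where
        V : Invariant c
        V = invariant-reachable reach
        K-avoids : ¬ (∀ i {q l q'} → gwState c i ≡ inj₁ q → (q , l , q') ∈ δh i → ¬ IsInput l)
        K-avoids no-input =
          Reachable≈-avoids (Deadlock K) Deadlock-resp free-K (reach-K V) (deadlock-K deadlock no-input)

    unspecified-local : ∀ {c i x} (x≢h : x ≢ h i) → Receiving (S (i , x)) (st c (i , x)) → InputsBlocked c (i , x)
      → UnspecifiedReception (Sᵢ i) (toSᵢ c i)
    unspecified-local {c} {i} {x} x≢h receiving blocked =
      x , subst (Receiving ⟦ M i x ⟧) (sym (localState-≢ c i x x≢h)) (receiving-S⇒local i x x≢h receiving)
        , λ s a q' t → blocked (i , s) a _
            (local⇒S-Δ c i x x≢h (subst (λ z → (z , recv s x a , q') ∈ CFSM.δ (M i x)) (localState-≢ c i x x≢h) t))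

    unspecified-interface : ∀ {c i q} → gwState c i ≡ inj₁ q → ¬ Final ⟦ Mh M h i ⟧ q → InputsBlocked c (i , h i)
      → ∀ {s a q'} → (q , recv s (h i) a , q') ∈ δh i → UnspecifiedReception (Sᵢ i) (toSᵢ c i)
    unspecified-interface {c} {i} idle not-final blocked t =
      h i , subst (Receiving ⟦ Mh M h i ⟧) (sym (localState-gw idle)) (receiving-Mh i not-final t tt)
      , λ s a q' t' → let t'' = subst (λ z → (z , recv s (h i) a , q') ∈ δh i) (localState-gw idle) t' in
          blocked (i , s) a _ (gateway⇒S-Δ c i idle (in₁ t'' (proj₂ (policy-for-input i t''))))

    unspecified-policy : ∀ {c i q} → gwState c i ≡ inj₁ q → ¬ Final ⟦ Mh M h i ⟧ q → InputsBlocked c (i , h i)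
      → ∀ {r a q'} → (q , send (h i) r a , q') ∈ δh i → UnspecifiedReception K (toK c)
    unspecified-policy {c} {i} {q} idle not-final blocked t =
      i , subst (Receiving (K i)) (sym (cong (policyView i) idle))
            ((λ final → not-final (final-K⇒Mh i final)) , inputs)
        , λ j a q' m → let m' = policy-at-idle c idle m in
            blocked (j , h j) a _ (gateway⇒S-Δ c i idle (out₁ (proj₂ (justifying-output i m')) m'))
      where
        inputs : ∀ l q' → (q , l , q') ∈ δ̇ i → IsInput l
        inputs (recv _ _ _) _ _ = tt
        inputs (send _ _ _) _ m with policy-justified i m
        ... | refl , _ , _ , t' = ⊥-elim (no-mixed i q ((_ , _ , t , tt) , (_ , _ , t' , tt)))

    receptionErrorFree-transfer : (∀ i → ReceptionErrorFree (Sᵢ i)) → ReceptionErrorFree K → ReceptionErrorFree S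
    receptionErrorFree-transfer free-Sᵢ free-K c reach ((i , x) , receiving , blocked) =
      by-cases (dec i x (h i)) receiving blocked
      where
        V : Invariant c
        V = invariant-reachable reach
        Sᵢ-avoids : ¬ UnspecifiedReception (Sᵢ i) (toSᵢ c i)
        Sᵢ-avoids =
          Reachable≈-avoids (UnspecifiedReception (Sᵢ i)) UnspecifiedReception-resp (free-Sᵢ i) (reach-Sᵢ V i)
        K-avoids : ¬ UnspecifiedReception K (toK c)
        K-avoids = Reachable≈-avoids (UnspecifiedReception K) UnspecifiedReception-resp free-K (reach-K V)
        by-cases : Dec (x ≡ h i) → Receiving (S (i , x)) (st c (i , x)) → InputsBlocked c (i , x) → ⊥
        by-cases (no x≢h) receiving blocked = Sᵢ-avoids (unspecified-local x≢h receiving blocked)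
        by-cases (yes refl) receiving blocked
          with receiving-gateway-idle i (gwState c i) (transport-pred Receiving (S-gateway i) receiving)
        ... | q , idle , not-final = not-final offers-nothing
          where
            offers-nothing : Final ⟦ Mh M h i ⟧ q
            offers-nothing (recv _ _ _) _ t with named i (h i) t
            ... | refl , _ = Sᵢ-avoids (unspecified-interface {c = c} idle not-final blocked t)
            offers-nothing (send _ _ _) _ t with named i (h i) t
            ... | refl , _ = K-avoids (unspecified-policy {c = c} idle not-final blocked t)

    gateway-idle-or-step : ∀ {c} → Invariant c → ∀ i → HasStep c ⊎ ∃ λ q → gwState c i ≡ inj₁ q
    gateway-idle-or-step {c} V i = by-cases (gwState c i) refl (live V i)
      where
        by-cases : (g : GS i) → gwState c i ≡ g → Live i g → HasStep c ⊎ ∃ λ q → gwState c i ≡ inj₁ q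
        by-cases (inj₁ q) idle _ = inj₂ (q , idle)
        by-cases (inj₂ _) midway (_ , _ , T@(out₂ _ _)) = inj₁ (send-enabled {c = c} (gateway⇒S-Δ c i midway T))
        by-cases (inj₂ _) midway (_ , _ , T@(in₂ _ _)) = inj₁ (send-enabled {c = c} (gateway⇒S-Δ c i midway T))

    Outputs : ∀ i → Qh i → Set
    Outputs i q = ∃ λ y → ∃ λ a → ∃ λ q' → (q , send (h i) y a , q') ∈ δh i

    Finished : Config S → I → Set
    Finished c i = ∃ λ q → gwState c i ≡ inj₁ q × Final ⟦ Mh M h i ⟧ q
                     × (∀ x → x ≢ h i → Final (S (i , x)) (st c (i , x)))

    Sᵢ-step-lifts : ∀ {c i q} → gwState c i ≡ inj₁ q → HasStep (toSᵢ c i) → HasStep c ⊎ Outputs i q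
    Sᵢ-step-lifts {c} {i} {q} idle (d' , send x y a , t , _) = by-cases (dec i x (h i)) t
      where
        by-cases : Dec (x ≡ h i) → (localState c i x , send x y a , st d' x) ∈ CFSM.δ (M i x)
          → HasStep c ⊎ Outputs i q
        by-cases (yes refl) t =
          inj₂ (y , a , _ , subst (λ z → (z , send (h i) y a , _) ∈ δh i) (localState-gw idle) t)
        by-cases (no x≢h) t = inj₁ (send-enabled {c = c} (local⇒S-Δ c i x x≢h
          (subst (λ z → (z , send x y a , st d' x) ∈ CFSM.δ (M i x)) (localState-≢ c i x x≢h) t)))
    Sᵢ-step-lifts {c} {i} {q} idle (d' , recv y x a , t , _ , shrink , _) =
      inj₁ (by-cases (dec i x (h i)) t shrink)
      where
        by-cases : Dec (x ≡ h i) → (localState c i x , recv y x a , st d' x) ∈ CFSM.δ (M i x)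
          → buf c (i , y) (i , x) ≡ a ∷ buf d' y x → HasStep c
        by-cases (yes refl) t shrink =
          let t' = subst (λ z → (z , recv y (h i) a , st d' (h i)) ∈ δh i) (localState-gw idle) t in
          recv-enabled {c = c} (gateway⇒S-Δ c i idle (in₁ t' (proj₂ (policy-for-input i t')))) shrink
        by-cases (no x≢h) t shrink = recv-enabled {c = c} (local⇒S-Δ c i x x≢h
          (subst (λ z → (z , recv y x a , st d' x) ∈ CFSM.δ (M i x)) (localState-≢ c i x x≢h) t)) shrink

    Sᵢ-final-lifts : ∀ {c i q} → gwState c i ≡ inj₁ q → AllFinal (Sᵢ i) (toSᵢ c i) → Finished c i
    Sᵢ-final-lifts {c} {i} {q} idle final = q , idle
      , subst (Final ⟦ Mh M h i ⟧) (localState-gw idle) (final (h i))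
      , λ x x≢h → final-local⇒S i x x≢h (subst (Final ⟦ M i x ⟧) (localState-≢ c i x x≢h) (final x))

    system-progress : (∀ i → HasProgress (Sᵢ i)) → ∀ {c} → Invariant c
      → ∀ i → HasStep c ⊎ (∃ λ q → gwState c i ≡ inj₁ q × Outputs i q) ⊎ Finished c i
    system-progress progress-Sᵢ V i with gateway-idle-or-step V i
    ... | inj₁ step = inj₁ step
    ... | inj₂ (q , idle) with Reachable≈-progress (progress-Sᵢ i) (reach-Sᵢ V i)
    ...   | inj₁ step-i = map₂ (λ out → inj₁ (q , idle , out)) (Sᵢ-step-lifts idle step-i)
    ...   | inj₂ final = inj₂ (inj₂ (Sᵢ-final-lifts idle final))

    K-step-lifts : (∀ i → HasProgress (Sᵢ i)) → ∀ {c} → Invariant c → HasStep (toK c) → HasStep c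
    K-step-lifts progress-Sᵢ {c} V (_ , send i j a , m , _) with system-progress progress-Sᵢ V i
    ... | inj₁ step = step
    ... | inj₂ (inj₁ (q , idle , _ , _ , _ , output)) =
      let _ , input = justifying-input i (policy-at-idle c idle m) in
      ⊥-elim (no-mixed i q ((_ , _ , output , tt) , (_ , _ , input , tt)))
    ... | inj₂ (inj₂ (q , idle , final , _)) =
      let _ , input = justifying-input i (policy-at-idle c idle m) in
      ⊥-elim (final _ _ input)
    K-step-lifts progress-Sᵢ {c} V (_ , recv j i a , m , _ , shrink , _) with gateway-idle-or-step V i
    ... | inj₁ step = step
    ... | inj₂ (q , idle) =
      let m' = policy-at-idle c idle m in
      recv-enabled {c = c} (gateway⇒S-Δ c i idle (out₁ (proj₂ (justifying-output i m')) m')) shrink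

    step-or-finished : (∀ i → HasProgress (Sᵢ i)) → ∀ {c} → Invariant c → AllFinal K (toK c)
      → ∀ i → HasStep c ⊎ Finished c i
    step-or-finished progress-Sᵢ V final-K i with system-progress progress-Sᵢ V i
    ... | inj₁ step = inj₁ step
    ... | inj₂ (inj₂ finished) = inj₂ finished
    ... | inj₂ (inj₁ (q , idle , _ , _ , _ , t)) =
      ⊥-elim (final-K⇒Mh i (subst (Final (K i)) (cong (policyView i) idle) (final-K i)) _ _ t)

    allFinal-finished : ∀ c → (∀ i → Finished c i) → AllFinal S c
    allFinal-finished c finished (i , x) = by-cases (dec i x (h i))
      where
        by-cases : Dec (x ≡ h i) → Final (S (i , x)) (st c (i , x))
        by-cases (yes refl) = let _ , idle , final , _ = finished i in
          transport-pred⁻ Final (S-gateway i) (subst (Final (G i)) (sym idle) (final-Mh⇒G i final))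
        by-cases (no x≢h) = proj₂ (proj₂ (proj₂ (finished i))) x x≢h

    progress-transfer : (∀ i → HasProgress (Sᵢ i)) → HasProgress K → HasProgress S
    progress-transfer progress-Sᵢ progress-K c reach =
      [ (λ step-K → inj₁ (K-step-lifts progress-Sᵢ V step-K))
      , (λ final-K → map₂ (allFinal-finished c) (finite-⊎-∀ finI (step-or-finished progress-Sᵢ V final-K))) ]′
      (Reachable≈-progress progress-K (reach-K V))
      where
        V : Invariant c
        V = invariant-reachable reach

theorem5p1 : (I : Set) → Finite I
    → (P : I → Set) → (dec : ∀ i → DecidableEquality (P i))
    → (M : (i : I) → P i → CFSM (P i))
    → (∀ i → IsCommSystem (M i))
    → (h : (i : I) → P i)
    → (CM : I → Msg → I → Set) → IsConnectionModel M h CM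
    → (δ̇ : (i : I) → List (DTrans M h i)) → IsConnectionPolicy M h CM δ̇
    → (𝒫 : Property)
    → (𝒫 ≢ orphanMessageFreedom → ∀ i q → ¬ Mixed ⟦ Mh M h i ⟧ q)
    → (∀ i → Holds 𝒫 (systemOf (M i)))
    → Holds 𝒫 (policySystem M h δ̇)
    → Holds 𝒫 (multicomposition M h dec δ̇)
theorem5p1 I finI P dec M cs h CM _ δ̇ pol 𝒫 no-mixed = transfer 𝒫 no-mixed
  where
    open Multicomposition finI dec M cs h CM δ̇ pol
    transfer : ∀ 𝒫 → (𝒫 ≢ orphanMessageFreedom → NoMixed) → (∀ i → Holds 𝒫 (Sᵢ i)) → Holds 𝒫 K → Holds 𝒫 S
    transfer deadlockFreedom       no-mixed = deadlockFree-transfer (no-mixed λ ())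
    transfer receptionErrorFreedom no-mixed = receptionErrorFree-transfer (no-mixed λ ())
    transfer progress              no-mixed = progress-transfer (no-mixed λ ())
    transfer orphanMessageFreedom  _        = orphanMessageFree-transfer
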